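{- Let $l\geq 1$, let $n_1,\ldots,n_l\geq 1$ be integers and let $u_1,\ldots,u_l\in\mathbb{Q}^+$. The system of conditions $R_{n_i}(u_i\cdot x)$, $i=1,\ldots,l$, has a solution $x\in\mathbb{Q}^+$ if and only if for every $i\neq j$ the relation $R_{(n_i,n_j)}(u_i\cdot u_j^{ -1})$ holds, where $(n_i,n_j)$ is the greatest common divisor of $n_i$ and $n_j$. Moreover, if $R_{(n_i,n_j)}(u_i\cdot u_j^{ -1})$ holds for all $i\neq j$, then letting $n=[n_1,\ldots,n_l]$ be the least common multiple of the $n_i$ and fixing integers $c_1,\ldots,c_l\in\mathbb{Z}$ with $\sum_{i=1}^l c_i\cdot n/n_i=1$, the solutions $x\in\mathbb{Q}^+$ of the system are exactly the numbers $w^n\cdot\prod_{i=1}^{l}u_i^{ -c_i\cdot n/n_i}$ with $w\in\mathbb{Q}^+$.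
   Context: $\mathbb{Q}^+=\{r\in\mathbb{Q}: r>0\}$. For an integer $d\geq 1$ and $x\in\mathbb{Q}^+$, $R_d(x)$ means that $x$ is the $d$-th power of a rational number, i.e. $\exists y\,[x=y^d]$. Integers $c_i$ as in the statement exist since $\gcd(n/n_1,\ldots,n/n_l)=1$. -}

module Defs where

open import Data.Nat as ℕ using (ℕ; zero; suc)
open import Data.Nat.LCM using (lcm)
open import Data.Integer as ℤ using (ℤ; +_; -[1+_])
open import Data.Rational as ℚ using (ℚ; NonZero; 1ℚ; 0ℚ; 1/_)
open import Data.Fin using (Fin; zero; suc)
open import Data.Product using (∃)
open import Relation.Binary.PropositionalEquality using (_≡_)

_^ℕ_ : ℚ → ℕ → ℚ
q ^ℕ zero = 1ℚ
q ^ℕ suc k = q ℚ.* (q ^ℕ k)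

_^ℤ_ : (q : ℚ) → .{{NonZero q}} → ℤ → ℚ
q ^ℤ (+ k) = q ^ℕ k
q ^ℤ -[1+ k ] = (1/ q) ^ℕ suc k

R : ℕ → ℚ → Set
R d x = ∃ λ (y : ℚ) → x ≡ y ^ℕ d

Σℤ : (l : ℕ) → (Fin l → ℤ) → ℤ
Σℤ zero f = + 0
Σℤ (suc l) f = f zero ℤ.+ Σℤ l (λ i → f (suc i))

Πℚ : (l : ℕ) → (Fin l → ℚ) → ℚ
Πℚ zero f = 1ℚ
Πℚ (suc l) f = f zero ℚ.* Πℚ l (λ i → f (suc i))

lcmF : (l : ℕ) → (Fin l → ℕ) → ℕ
lcmF zero f = 1
lcmF (suc l) f = lcm (f zero) (lcmF l (λ i → f (suc i)))

-- If u_i x = y_i ^ n_i, then u_i / u_j = (u_i x) / (u_j x) is a g-th power for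
-- g = (n_i, n_j), as g divides both exponents. Conversely put e_i = c_i n / n_i, so
-- that Σ e_i = 1. For a solution x with positive roots y_i, the number
-- w = ∏ y_i ^ c_i satisfies w ^ n = ∏ (u_i x) ^ e_i = x ∏ u_i ^ e_i. For
-- x = w ^ n ∏ u_j ^ -e_j one has u_i x = w ^ n ∏_j (u_i / u_j) ^ e_j, and each factor
-- is an n_i-th power because n_i divides (n_i, n_j) n / n_j. Taking w = 1 shows that
-- the compatibility conditions make the system solvable.

module Submission where

open import Defs
open import Algebra.Bundles using (CommutativeRing; CommutativeMonoid)
open import Data.Fin using (Fin; zero; suc; _≟_)
open import Data.Integer as ℤ using (ℤ; +_; -[1+_]; _⊖_)
import Data.Integer.Properties as ℤ
open import Data.Integer.Solver using (module +-*-Solver)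
open import Data.Nat as ℕ using (ℕ; zero; suc; _≤_; >-nonZero; _/_)
import Data.Nat.Properties as ℕ
open import Data.Nat.Divisibility
open import Data.Nat.DivMod using (m*[n/m]≡n; *-/-assoc)
open import Data.Nat.GCD
  using (gcd; gcd-GCD; gcd[m,n]∣m; gcd[m,n]∣n; gcd[m,n]≢0; gcd-greatest; c*gcd[m,n]≡gcd[cm,cn]; module Bézout)
open import Data.Nat.LCM using (lcm; m∣lcm[m,n]; n∣lcm[m,n]; lcm-least; gcd*lcm)
open import Data.Rational as ℚ using (ℚ; Positive; NonZero; _*_; 1/_; 1ℚ; 0ℚ; ∣_∣)
open import Data.Rational.Properties as ℚ using (pos⇒nonZero; pos*pos⇒pos; 1/pos⇒pos)
open import Data.Product using (∃; ∃₂; _×_; _,_; proj₁; proj₂)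
open import Data.Sum using (inj₁)
open import Function.Bundles using (_⇔_; mk⇔)
open import Relation.Binary.PropositionalEquality
open import Relation.Nullary using (yes; no)

open import Algebra.Properties.CommutativeSemiring.Exp
  (CommutativeRing.commutativeSemiring ℚ.+-*-commutativeRing)
  using (_^_; ^-homo-*; ^-assocʳ; ^-distrib-*)
open import Algebra.Properties.CommutativeSemigroup
  (CommutativeMonoid.commutativeSemigroup ℚ.*-1-commutativeMonoid)
  using (interchange; xy∙z≈y∙xz; x∙yz≈y∙xz)

open ≡-Reasoning

invertible⇒nonZero : ∀ a b → a * b ≡ 1ℚ → NonZero a
invertible⇒nonZero a b ab≡1 = ℚ.≢-nonZero {a} λ a≡0 →
  ℚ.1≢0 (trans (sym ab≡1) (trans (cong (_* b) a≡0) (ℚ.*-zeroˡ b)))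

inverse-unique : ∀ a .{{_ : NonZero a}} {b} → a * b ≡ 1ℚ → b ≡ 1/ a
inverse-unique a {b} ab≡1 = begin
  b                ≡⟨ sym (ℚ.*-identityˡ b) ⟩
  1ℚ * b           ≡⟨ cong (_* b) (sym (ℚ.*-inverseˡ a)) ⟩
  (1/ a * a) * b   ≡⟨ ℚ.*-assoc (1/ a) a b ⟩
  1/ a * (a * b)   ≡⟨ cong (1/ a *_) ab≡1 ⟩
  1/ a * 1ℚ        ≡⟨ ℚ.*-identityʳ (1/ a) ⟩
  1/ a             ∎

*-inverse-* : ∀ a .{{_ : NonZero a}} b .{{_ : NonZero b}} → (a * b) * (1/ a * 1/ b) ≡ 1ℚ
*-inverse-* a b = trans (interchange a b (1/ a) (1/ b))
  (cong₂ _*_ (ℚ.*-inverseʳ a) (ℚ.*-inverseʳ b))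

*-nonZero : ∀ a .{{_ : NonZero a}} b .{{_ : NonZero b}} → NonZero (a * b)
*-nonZero a b = invertible⇒nonZero (a * b) (1/ a * 1/ b) (*-inverse-* a b)

1/-distrib-* : ∀ a .{{_ : NonZero a}} b .{{_ : NonZero b}} →
  (1/ (a * b)) {{*-nonZero a b}} ≡ 1/ a * 1/ b
1/-distrib-* a b = sym (inverse-unique (a * b) {{*-nonZero a b}} (*-inverse-* a b))

*-1/-cancelʳ : ∀ a b .{{_ : NonZero b}} x .{{_ : NonZero x}} →
  (a * x) * (1/ (b * x)) {{*-nonZero b x}} ≡ a * 1/ b
*-1/-cancelʳ a b x = begin
  (a * x) * 1/ (b * x)     ≡⟨ cong ((a * x) *_) (1/-distrib-* b x) ⟩
  (a * x) * (1/ b * 1/ x)  ≡⟨ interchange a x (1/ b) (1/ x) ⟩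
  (a * 1/ b) * (x * 1/ x)  ≡⟨ cong ((a * 1/ b) *_) (ℚ.*-inverseʳ x) ⟩
  (a * 1/ b) * 1ℚ          ≡⟨ ℚ.*-identityʳ (a * 1/ b) ⟩
  a * 1/ b                 ∎
  where instance _ = *-nonZero b x

-- natural powers

^ℕ≡^ : ∀ a k → a ^ℕ k ≡ a ^ k
^ℕ≡^ a zero    = refl
^ℕ≡^ a (suc k) = cong (a *_) (^ℕ≡^ a k)

^ℕ-+ : ∀ a m k → a ^ℕ (m ℕ.+ k) ≡ a ^ℕ m * a ^ℕ k
^ℕ-+ a m k rewrite ^ℕ≡^ a (m ℕ.+ k) | ^ℕ≡^ a m | ^ℕ≡^ a k = ^-homo-* a m k

^ℕ-* : ∀ a m k → a ^ℕ (m ℕ.* k) ≡ (a ^ℕ m) ^ℕ k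
^ℕ-* a m k rewrite ^ℕ≡^ a (m ℕ.* k) | ^ℕ≡^ a m | ^ℕ≡^ (a ^ m) k = sym (^-assocʳ a m k)

^ℕ-distrib-* : ∀ a b k → (a * b) ^ℕ k ≡ a ^ℕ k * b ^ℕ k
^ℕ-distrib-* a b k rewrite ^ℕ≡^ (a * b) k | ^ℕ≡^ a k | ^ℕ≡^ b k = ^-distrib-* a b k

1^ℕ : ∀ k → 1ℚ ^ℕ k ≡ 1ℚ
1^ℕ zero    = refl
1^ℕ (suc k) = trans (ℚ.*-identityˡ _) (1^ℕ k)

^ℕ-positive : ∀ a .{{_ : Positive a}} k → Positive (a ^ℕ k)
^ℕ-positive a zero    = _
^ℕ-positive a (suc k) = pos*pos⇒pos a (a ^ℕ k) {{^ℕ-positive a k}}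

^ℕ-inverse : ∀ a .{{_ : NonZero a}} k → a ^ℕ k * (1/ a) ^ℕ k ≡ 1ℚ
^ℕ-inverse a k = begin
  a ^ℕ k * (1/ a) ^ℕ k ≡⟨ sym (^ℕ-distrib-* a (1/ a) k) ⟩
  (a * 1/ a) ^ℕ k      ≡⟨ cong (_^ℕ k) (ℚ.*-inverseʳ a) ⟩
  1ℚ ^ℕ k              ≡⟨ 1^ℕ k ⟩
  1ℚ                   ∎

^ℕ-nonZero : ∀ a .{{_ : NonZero a}} k → NonZero (a ^ℕ k)
^ℕ-nonZero a k = invertible⇒nonZero (a ^ℕ k) ((1/ a) ^ℕ k) (^ℕ-inverse a k)

1/-^ℕ : ∀ a .{{_ : NonZero a}} k → (1/ (a ^ℕ k)) {{^ℕ-nonZero a k}} ≡ (1/ a) ^ℕ k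
1/-^ℕ a k = sym (inverse-unique (a ^ℕ k) {{^ℕ-nonZero a k}} (^ℕ-inverse a k))

-- integer powers

^ℤ-congˡ : ∀ {a b} .{a≢0 : NonZero a} .{b≢0 : NonZero b} i → a ≡ b →
  _^ℤ_ a {{a≢0}} i ≡ _^ℤ_ b {{b≢0}} i
^ℤ-congˡ i refl = refl

^ℤ-positive : ∀ a .{{_ : Positive a}} i → Positive (_^ℤ_ a {{pos⇒nonZero a}} i)
^ℤ-positive a (+ k)    = ^ℕ-positive a k
^ℤ-positive a -[1+ k ] = ^ℕ-positive ((1/ a) {{pos⇒nonZero a}}) {{1/pos⇒pos a}} (suc k)

^ℤ-⊖ : ∀ a .{{_ : NonZero a}} p q → a ^ℤ (p ⊖ q) ≡ a ^ℕ p * (1/ a) ^ℕ q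
^ℤ-⊖ a p zero = begin
  a ^ℤ (p ⊖ 0)         ≡⟨ cong (a ^ℤ_) (ℤ.⊖-≥ {p} {0} ℕ.z≤n) ⟩
  a ^ℕ p               ≡⟨ ℚ.*-identityʳ (a ^ℕ p) ⟨
  a ^ℕ p * 1ℚ          ∎
^ℤ-⊖ a zero (suc q) = begin
  a ^ℤ (0 ⊖ suc q)     ≡⟨ cong (a ^ℤ_) (ℤ.⊖-< {0} {suc q} ℕ.z<s) ⟩
  (1/ a) ^ℕ suc q      ≡⟨ ℚ.*-identityˡ _ ⟨
  1ℚ * (1/ a) ^ℕ suc q ∎
^ℤ-⊖ a (suc p) (suc q) = begin
  a ^ℤ (suc p ⊖ suc q)                 ≡⟨ cong (a ^ℤ_) (ℤ.[1+m]⊖[1+n]≡m⊖n p q) ⟩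
  a ^ℤ (p ⊖ q)                         ≡⟨ ^ℤ-⊖ a p q ⟩
  a ^ℕ p * (1/ a) ^ℕ q                 ≡⟨ ℚ.*-identityˡ _ ⟨
  1ℚ * (a ^ℕ p * (1/ a) ^ℕ q)          ≡⟨ cong (_* (a ^ℕ p * (1/ a) ^ℕ q)) (ℚ.*-inverseʳ a) ⟨
  (a * 1/ a) * (a ^ℕ p * (1/ a) ^ℕ q)  ≡⟨ interchange a (1/ a) (a ^ℕ p) ((1/ a) ^ℕ q) ⟩
  a ^ℕ suc p * (1/ a) ^ℕ suc q         ∎

^ℤ-difference : ∀ a .{{_ : NonZero a}} p q → a ^ℤ (+ p ℤ.- + q) ≡ a ^ℕ p * (1/ a) ^ℕ q
^ℤ-difference a p q = trans (cong (a ^ℤ_) (ℤ.[+m]-[+n]≡m⊖n p q)) (^ℤ-⊖ a p q)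

difference-form : ∀ i → ∃₂ λ p q → i ≡ + p ℤ.- + q
difference-form (+ p)    = p , 0 , sym (ℤ.+-identityʳ (+ p))
difference-form -[1+ q ] = 0 , suc q , refl

^ℤ-+ : ∀ a .{{_ : NonZero a}} i j → a ^ℤ (i ℤ.+ j) ≡ a ^ℤ i * a ^ℤ j
^ℤ-+ a i j with difference-form i | difference-form j
... | p , q , refl | p′ , q′ , refl = begin
  a ^ℤ ((+ p ℤ.- + q) ℤ.+ (+ p′ ℤ.- + q′))              ≡⟨ cong (a ^ℤ_) regroup ⟩
  a ^ℤ (+ (p ℕ.+ p′) ℤ.- + (q ℕ.+ q′))                   ≡⟨ ^ℤ-difference a (p ℕ.+ p′) (q ℕ.+ q′) ⟩
  a ^ℕ (p ℕ.+ p′) * (1/ a) ^ℕ (q ℕ.+ q′)                 ≡⟨ cong₂ _*_ (^ℕ-+ a p p′) (^ℕ-+ (1/ a) q q′) ⟩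
  (a ^ℕ p * a ^ℕ p′) * ((1/ a) ^ℕ q * (1/ a) ^ℕ q′)      ≡⟨ interchange (a ^ℕ p) _ _ _ ⟩
  (a ^ℕ p * (1/ a) ^ℕ q) * (a ^ℕ p′ * (1/ a) ^ℕ q′)
    ≡⟨ cong₂ _*_ (^ℤ-difference a p q) (^ℤ-difference a p′ q′) ⟨
  a ^ℤ (+ p ℤ.- + q) * a ^ℤ (+ p′ ℤ.- + q′)              ∎
  where
  open +-*-Solver
  regroup : (+ p ℤ.- + q) ℤ.+ (+ p′ ℤ.- + q′) ≡ + (p ℕ.+ p′) ℤ.- + (q ℕ.+ q′)
  regroup rewrite ℤ.pos-+ p p′ | ℤ.pos-+ q q′ =
    solve 4 (λ p q p′ q′ → (p :- q) :+ (p′ :- q′) := (p :+ p′) :- (q :+ q′))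
      refl (+ p) (+ q) (+ p′) (+ q′)

^ℤ-inverse : ∀ a .{{_ : NonZero a}} i → a ^ℤ i * a ^ℤ (ℤ.- i) ≡ 1ℚ
^ℤ-inverse a i = trans (sym (^ℤ-+ a i (ℤ.- i))) (cong (a ^ℤ_) (ℤ.+-inverseʳ i))

^ℤ-nonZero : ∀ a .{{_ : NonZero a}} i → NonZero (a ^ℤ i)
^ℤ-nonZero a i = invertible⇒nonZero (a ^ℤ i) (a ^ℤ (ℤ.- i)) (^ℤ-inverse a i)

^ℤ-neg : ∀ a .{{_ : NonZero a}} i → a ^ℤ (ℤ.- i) ≡ (1/ (a ^ℤ i)) {{^ℤ-nonZero a i}}
^ℤ-neg a i = inverse-unique (a ^ℤ i) {{^ℤ-nonZero a i}} (^ℤ-inverse a i)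

^ℤ-^ℕ : ∀ a .{{_ : NonZero a}} i k → (a ^ℤ i) ^ℕ k ≡ a ^ℤ (i ℤ.* + k)
^ℤ-^ℕ a i zero    = cong (a ^ℤ_) (sym (ℤ.*-zeroʳ i))
^ℤ-^ℕ a i (suc k) = begin
  a ^ℤ i * (a ^ℤ i) ^ℕ k    ≡⟨ cong (a ^ℤ i *_) (^ℤ-^ℕ a i k) ⟩
  a ^ℤ i * a ^ℤ (i ℤ.* + k) ≡⟨ ^ℤ-+ a i (i ℤ.* + k) ⟨
  a ^ℤ (i ℤ.+ i ℤ.* + k)    ≡⟨ cong (a ^ℤ_) (ℤ.*-suc i (+ k)) ⟨
  a ^ℤ (i ℤ.* + suc k)      ∎

^ℤ-* : ∀ a .{{_ : NonZero a}} i j → _^ℤ_ (a ^ℤ i) {{^ℤ-nonZero a i}} j ≡ a ^ℤ (i ℤ.* j)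
^ℤ-* a i j with difference-form j
... | p , q , refl = begin
  (a ^ℤ i) ^ℤ (+ p ℤ.- + q)                           ≡⟨ ^ℤ-difference (a ^ℤ i) p q ⟩
  (a ^ℤ i) ^ℕ p * (1/ (a ^ℤ i)) ^ℕ q                  ≡⟨ cong (λ b → (a ^ℤ i) ^ℕ p * b ^ℕ q) (^ℤ-neg a i) ⟨
  (a ^ℤ i) ^ℕ p * (a ^ℤ (ℤ.- i)) ^ℕ q                 ≡⟨ cong₂ _*_ (^ℤ-^ℕ a i p) (^ℤ-^ℕ a (ℤ.- i) q) ⟩
  a ^ℤ (i ℤ.* + p) * a ^ℤ (ℤ.- i ℤ.* + q)             ≡⟨ ^ℤ-+ a (i ℤ.* + p) (ℤ.- i ℤ.* + q) ⟨
  a ^ℤ (i ℤ.* + p ℤ.+ ℤ.- i ℤ.* + q)                  ≡⟨ cong (a ^ℤ_) distribute ⟩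
  a ^ℤ (i ℤ.* (+ p ℤ.- + q))                          ∎
  where
  instance _ = ^ℤ-nonZero a i
  open +-*-Solver
  distribute : i ℤ.* + p ℤ.+ ℤ.- i ℤ.* + q ≡ i ℤ.* (+ p ℤ.- + q)
  distribute = solve 3 (λ i p q → i :* p :+ :- i :* q := i :* (p :- q)) refl i (+ p) (+ q)

^ℤ-distrib-* : ∀ a .{{_ : NonZero a}} b .{{_ : NonZero b}} i →
  (_^ℤ_ (a * b) {{*-nonZero a b}} i) ≡ a ^ℤ i * b ^ℤ i
^ℤ-distrib-* a b i with difference-form i
... | p , q , refl = begin
  (a * b) ^ℤ (+ p ℤ.- + q)                          ≡⟨ ^ℤ-difference (a * b) p q ⟩
  (a * b) ^ℕ p * (1/ (a * b)) ^ℕ q                  ≡⟨ cong (λ c → (a * b) ^ℕ p * c ^ℕ q) (1/-distrib-* a b) ⟩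
  (a * b) ^ℕ p * (1/ a * 1/ b) ^ℕ q
    ≡⟨ cong₂ _*_ (^ℕ-distrib-* a b p) (^ℕ-distrib-* (1/ a) (1/ b) q) ⟩
  (a ^ℕ p * b ^ℕ p) * ((1/ a) ^ℕ q * (1/ b) ^ℕ q)   ≡⟨ interchange (a ^ℕ p) _ _ _ ⟩
  (a ^ℕ p * (1/ a) ^ℕ q) * (b ^ℕ p * (1/ b) ^ℕ q)
    ≡⟨ cong₂ _*_ (^ℤ-difference a p q) (^ℤ-difference b p q) ⟨
  a ^ℤ (+ p ℤ.- + q) * b ^ℤ (+ p ℤ.- + q)           ∎
  where instance _ = *-nonZero a b

1/-^ℤ : ∀ a .{{_ : NonZero a}} i → _^ℤ_ (1/ a) {{ℚ.nonZero⇒1/nonZero a}} i ≡ a ^ℤ (ℤ.- i)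
1/-^ℤ a i = begin
  (1/ a) ^ℤ i              ≡⟨ ^ℤ-congˡ i (ℚ.*-identityʳ (1/ a)) ⟨
  (a ^ℤ ℤ.-[1+ 0 ]) ^ℤ i   ≡⟨ ^ℤ-* a ℤ.-[1+ 0 ] i ⟩
  a ^ℤ (ℤ.-1ℤ ℤ.* i)       ≡⟨ cong (a ^ℤ_) (ℤ.-1*i≡-i i) ⟩
  a ^ℤ (ℤ.- i)             ∎
  where instance _ = ℚ.nonZero⇒1/nonZero a
                 _ = ^ℤ-nonZero a ℤ.-[1+ 0 ]

-- finite products

Πℚ-cong : ∀ l {f g : Fin l → ℚ} → (∀ i → f i ≡ g i) → Πℚ l f ≡ Πℚ l g
Πℚ-cong zero    f≗g = refl
Πℚ-cong (suc l) f≗g = cong₂ _*_ (f≗g zero) (Πℚ-cong l (λ i → f≗g (suc i)))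

Πℚ-* : ∀ l (f g : Fin l → ℚ) → Πℚ l (λ i → f i * g i) ≡ Πℚ l f * Πℚ l g
Πℚ-* zero    f g = refl
Πℚ-* (suc l) f g = trans (cong (f zero * g zero *_) (Πℚ-* l (λ i → f (suc i)) (λ i → g (suc i))))
  (interchange (f zero) (g zero) _ _)

Πℚ-^ℕ : ∀ l (f : Fin l → ℚ) k → Πℚ l f ^ℕ k ≡ Πℚ l (λ i → f i ^ℕ k)
Πℚ-^ℕ zero    f k = 1^ℕ k
Πℚ-^ℕ (suc l) f k = trans (^ℕ-distrib-* (f zero) _ k)
  (cong (f zero ^ℕ k *_) (Πℚ-^ℕ l (λ i → f (suc i)) k))

Πℚ-^ℤ : ∀ a .{{_ : NonZero a}} l (e : Fin l → ℤ) → Πℚ l (λ i → a ^ℤ e i) ≡ a ^ℤ Σℤ l e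
Πℚ-^ℤ a zero    e = refl
Πℚ-^ℤ a (suc l) e = trans (cong (a ^ℤ e zero *_) (Πℚ-^ℤ a l (λ i → e (suc i))))
  (sym (^ℤ-+ a (e zero) _))

Πℚ-positive : ∀ l (f : Fin l → ℚ) → (∀ i → Positive (f i)) → Positive (Πℚ l f)
Πℚ-positive zero    f pos = _
Πℚ-positive (suc l) f pos =
  pos*pos⇒pos (f zero) {{pos zero}} _ {{Πℚ-positive l (λ i → f (suc i)) (λ i → pos (suc i))}}

-- perfect powers

R-1 : ∀ d → R d 1ℚ
R-1 d = 1ℚ , sym (1^ℕ d)

R-* : ∀ {d a b} → R d a → R d b → R d (a * b)
R-* {d} (y , refl) (z , refl) = y * z , sym (^ℕ-distrib-* y z d)

R-Πℚ : ∀ d l (f : Fin l → ℚ) → (∀ i → R d (f i)) → R d (Πℚ l f)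
R-Πℚ d zero    f R-f = R-1 d
R-Πℚ d (suc l) f R-f = R-* {d} (R-f zero) (R-Πℚ d l (λ i → f (suc i)) (λ i → R-f (suc i)))

R-∣ : ∀ {d n a} → d ∣ n → R n a → R d a
R-∣ {d} (divides k refl) (y , refl) = y ^ℕ k , ^ℕ-* y k d

^ℕ-absolute : ∀ y k → ∣ y ^ℕ k ∣ ≡ ∣ y ∣ ^ℕ k
^ℕ-absolute y zero    = refl
^ℕ-absolute y (suc k) = trans (ℚ.∣p*q∣≡∣p∣*∣q∣ y (y ^ℕ k)) (cong (∣ y ∣ *_) (^ℕ-absolute y k))

R-positive-root : ∀ {d a} .{{_ : Positive a}} → 1 ≤ d → R d a →
  ∃ λ y → Positive y × a ≡ y ^ℕ d
R-positive-root {suc d} {a} _ (y , a≡y^d) = ∣ y ∣ , ∣y∣>0 , (begin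
  a              ≡⟨ ℚ.0≤p⇒∣p∣≡p (ℚ.<⇒≤ (ℚ.positive⁻¹ a)) ⟨
  ∣ a ∣          ≡⟨ cong ∣_∣ a≡y^d ⟩
  ∣ y ^ℕ suc d ∣ ≡⟨ ^ℕ-absolute y (suc d) ⟩
  ∣ y ∣ ^ℕ suc d ∎)
  where
  y≢0 : y ≢ 0ℚ
  y≢0 refl = ℚ.<-irrefl refl
    (subst (0ℚ ℚ.<_) (trans a≡y^d (ℚ.*-zeroˡ (0ℚ ^ℕ d))) (ℚ.positive⁻¹ a))
  ∣y∣>0 : Positive ∣ y ∣
  ∣y∣>0 = ℚ.nonNeg∧nonZero⇒pos ∣ y ∣ {{ℚ.∣-∣-nonNeg y}}
    {{ℚ.≢-nonZero (λ ∣y∣≡0 → y≢0 (ℚ.∣p∣≡0⇒p≡0 y ∣y∣≡0))}}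

R-1/ : ∀ {d a} .{{_ : Positive a}} → 1 ≤ d → R d a → R d ((1/ a) {{pos⇒nonZero a}})
R-1/ {d} 1≤d R-a with R-positive-root 1≤d R-a
... | y , y>0 , refl = (1/ y) {{pos⇒nonZero y {{y>0}}}} ,
  1/-^ℕ y {{pos⇒nonZero y {{y>0}}}} d

R-^ℤ : ∀ {g n t a} .{{_ : Positive a}} → 1 ≤ g → R g a → n ∣ t ℕ.* g →
  ∀ c → R n (_^ℤ_ a {{pos⇒nonZero a}} (c ℤ.* + t))
R-^ℤ {g} {n} {t} 1≤g R-a n∣t·g c with R-positive-root 1≤g R-a | n∣t·g
... | z , z>0 , refl | divides k t·g≡k·n = z ^ℤ (c ℤ.* + k) , (begin
  (z ^ℕ g) ^ℤ (c ℤ.* + t)        ≡⟨ ^ℤ-* z (+ g) (c ℤ.* + t) ⟩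
  z ^ℤ (+ g ℤ.* (c ℤ.* + t))     ≡⟨ cong (z ^ℤ_) exponent ⟩
  z ^ℤ ((c ℤ.* + k) ℤ.* + n)     ≡⟨ ^ℤ-^ℕ z (c ℤ.* + k) n ⟨
  (z ^ℤ (c ℤ.* + k)) ^ℕ n        ∎)
  where
  instance _ = pos⇒nonZero z {{z>0}}
           _ = pos⇒nonZero (z ^ℕ g) {{^ℕ-positive z {{z>0}} g}}
  open +-*-Solver
  exponent : + g ℤ.* (c ℤ.* + t) ≡ (c ℤ.* + k) ℤ.* + n
  exponent = begin
    + g ℤ.* (c ℤ.* + t)   ≡⟨ solve 3 (λ g c t → g :* (c :* t) := c :* (t :* g)) refl (+ g) c (+ t) ⟩
    c ℤ.* (+ t ℤ.* + g)   ≡⟨ cong (c ℤ.*_) (ℤ.pos-* t g) ⟨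
    c ℤ.* + (t ℕ.* g)     ≡⟨ cong (λ m → c ℤ.* + m) t·g≡k·n ⟩
    c ℤ.* + (k ℕ.* n)     ≡⟨ cong (c ℤ.*_) (ℤ.pos-* k n) ⟩
    c ℤ.* (+ k ℤ.* + n)   ≡⟨ ℤ.*-assoc c (+ k) (+ n) ⟨
    (c ℤ.* + k) ℤ.* + n   ∎

-- exponent arithmetic

∣lcmF : ∀ l (f : Fin l → ℕ) i → f i ∣ lcmF l f
∣lcmF (suc l) f zero    = m∣lcm[m,n] (f zero) _
∣lcmF (suc l) f (suc i) = ∣-trans (∣lcmF l (λ j → f (suc j)) i) (n∣lcm[m,n] (f zero) _)

lcmF-least : ∀ l (f : Fin l → ℕ) {m} → (∀ i → f i ∣ m) → lcmF l f ∣ m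
lcmF-least zero    f {m} _   = 1∣ m
lcmF-least (suc l) f     f∣m =
  lcm-least (f∣m zero) (lcmF-least l (λ j → f (suc j)) (λ j → f∣m (suc j)))

lcm-nonZero : ∀ m n .{{_ : ℕ.NonZero m}} .{{_ : ℕ.NonZero n}} → ℕ.NonZero (lcm m n)
lcm-nonZero m n = ℕ.m*n≢0⇒n≢0 (gcd m n) {{subst ℕ.NonZero (sym (gcd*lcm m n)) (ℕ.m*n≢0 m n)}}

lcmF-nonZero : ∀ l (f : Fin l → ℕ) → (∀ i → ℕ.NonZero (f i)) → ℕ.NonZero (lcmF l f)
lcmF-nonZero zero    f f≢0 = _
lcmF-nonZero (suc l) f f≢0 = lcm-nonZero (f zero) _ {{f≢0 zero}}
  {{lcmF-nonZero l (λ j → f (suc j)) (λ j → f≢0 (suc j))}}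

∣*gcd : ∀ {m n} t → m ∣ t ℕ.* n → m ∣ t ℕ.* gcd m n
∣*gcd {m} {n} t m∣tn =
  subst (m ∣_) (sym (c*gcd[m,n]≡gcd[cm,cn] t m n)) (gcd-greatest (n∣m*n t) m∣tn)

m+n≡o⇒+m≡+o-+n : ∀ {m n o} → m ℕ.+ n ≡ o → + m ≡ + o ℤ.- + n
m+n≡o⇒+m≡+o-+n {m} {n} refl = begin
  + m                        ≡⟨ ℤ.+-identityʳ (+ m) ⟨
  + m ℤ.+ ℤ.0ℤ               ≡⟨ cong (ℤ._+_ (+ m)) (ℤ.+-inverseʳ (+ n)) ⟨
  + m ℤ.+ (+ n ℤ.- + n)      ≡⟨ ℤ.+-assoc (+ m) (+ n) (ℤ.- + n) ⟨
  + (m ℕ.+ n) ℤ.- + n        ∎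

bézout : ∀ m n → ∃₂ λ s t → s ℤ.* + m ℤ.+ t ℤ.* + n ≡ + gcd m n
bézout m n with Bézout.identity (gcd-GCD m n)
... | Bézout.+- x y eq = + x , ℤ.- + y , (begin
  + x ℤ.* + m ℤ.+ ℤ.- + y ℤ.* + n   ≡⟨ cong₂ ℤ._+_ (ℤ.pos-* x m) (ℤ.neg-distribˡ-* (+ y) (+ n)) ⟨
  + (x ℕ.* m) ℤ.- + y ℤ.* + n       ≡⟨ cong (λ k → + (x ℕ.* m) ℤ.- k) (ℤ.pos-* y n) ⟨
  + (x ℕ.* m) ℤ.- + (y ℕ.* n)       ≡⟨ m+n≡o⇒+m≡+o-+n eq ⟨
  + gcd m n                         ∎)
... | Bézout.-+ x y eq = ℤ.- + x , + y , (begin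
  ℤ.- + x ℤ.* + m ℤ.+ + y ℤ.* + n   ≡⟨ ℤ.+-comm (ℤ.- + x ℤ.* + m) (+ y ℤ.* + n) ⟩
  + y ℤ.* + n ℤ.+ ℤ.- + x ℤ.* + m   ≡⟨ cong₂ ℤ._+_ (ℤ.pos-* y n) (ℤ.neg-distribˡ-* (+ x) (+ m)) ⟨
  + (y ℕ.* n) ℤ.- + x ℤ.* + m       ≡⟨ cong (λ k → + (y ℕ.* n) ℤ.- k) (ℤ.pos-* x m) ⟨
  + (y ℕ.* n) ℤ.- + (x ℕ.* m)       ≡⟨ m+n≡o⇒+m≡+o-+n eq ⟨
  + gcd m n                         ∎)

Σℤ-cong : ∀ l {f g : Fin l → ℤ} → (∀ i → f i ≡ g i) → Σℤ l f ≡ Σℤ l g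
Σℤ-cong zero    f≗g = refl
Σℤ-cong (suc l) f≗g = cong₂ ℤ._+_ (f≗g zero) (Σℤ-cong l (λ i → f≗g (suc i)))

Σℤ-*ˡ : ∀ l k (f : Fin l → ℤ) → Σℤ l (λ i → k ℤ.* f i) ≡ k ℤ.* Σℤ l f
Σℤ-*ˡ zero    k f = sym (ℤ.*-zeroʳ k)
Σℤ-*ˡ (suc l) k f = trans (cong (ℤ._+_ (k ℤ.* f zero)) (Σℤ-*ˡ l k (λ i → f (suc i))))
  (sym (ℤ.*-distribˡ-+ k (f zero) _))

Σℤ-bézout : ∀ l (a : Fin l → ℕ) →
  ∃₂ λ (c : Fin l → ℤ) d → Σℤ l (λ i → c i ℤ.* + a i) ≡ + d × (∀ i → d ∣ a i)
Σℤ-bézout zero    a = (λ ()) , 0 , refl , (λ ())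
Σℤ-bézout (suc l) a with Σℤ-bézout l (λ i → a (suc i))
... | c′ , d′ , Σ≡d′ , d′∣a with bézout (a zero) d′
...   | s , t , s·a₀+t·d′≡g = c , gcd (a zero) d′ , Σ≡g , g∣a
  where
  c : Fin (suc l) → ℤ
  c zero    = s
  c (suc i) = t ℤ.* c′ i
  Σ≡g : Σℤ (suc l) (λ i → c i ℤ.* + a i) ≡ + gcd (a zero) d′
  Σ≡g = begin
    s ℤ.* + a zero ℤ.+ Σℤ l (λ i → (t ℤ.* c′ i) ℤ.* + a (suc i))
      ≡⟨ cong (ℤ._+_ (s ℤ.* + a zero)) (Σℤ-cong l (λ i → ℤ.*-assoc t (c′ i) _)) ⟩
    s ℤ.* + a zero ℤ.+ Σℤ l (λ i → t ℤ.* (c′ i ℤ.* + a (suc i)))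
      ≡⟨ cong (ℤ._+_ (s ℤ.* + a zero)) (trans (Σℤ-*ˡ l t _) (cong (t ℤ.*_) Σ≡d′)) ⟩
    s ℤ.* + a zero ℤ.+ t ℤ.* + d′
      ≡⟨ s·a₀+t·d′≡g ⟩
    + gcd (a zero) d′ ∎
  g∣a : ∀ i → gcd (a zero) d′ ∣ a i
  g∣a zero    = gcd[m,n]∣m (a zero) d′
  g∣a (suc i) = ∣-trans (gcd[m,n]∣n (a zero) d′) (d′∣a i)

lcmF-cofactors-bézout : ∀ l (f : Fin (suc l) → ℕ) (f≢0 : ∀ i → ℕ.NonZero (f i)) →
  ∃ λ (c : Fin (suc l) → ℤ) →
    Σℤ (suc l) (λ i → c i ℤ.* + (lcmF (suc l) f / f i) {{f≢0 i}}) ≡ + 1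
-- d divides every N / f i, so every f i divides N / d; minimality of N forces d = 1.
lcmF-cofactors-bézout l f f≢0 with Σℤ-bézout (suc l) (λ i → (lcmF (suc l) f / f i) {{f≢0 i}})
... | c , d , Σ≡d , d∣a = c , trans Σ≡d (cong +_ (∣1⇒≡1 d∣1))
  where
  N = lcmF (suc l) f
  instance N≢0 = lcmF-nonZero (suc l) f f≢0
  a : Fin (suc l) → ℕ
  a i = (N / f i) {{f≢0 i}}
  f·a≡N : ∀ i → f i ℕ.* a i ≡ N
  f·a≡N i = m*[n/m]≡n {{f≢0 i}} (∣lcmF (suc l) f i)
  a≢0 : ∀ i → ℕ.NonZero (a i)
  a≢0 i = ℕ.m*n≢0⇒n≢0 (f i) {{subst ℕ.NonZero (sym (f·a≡N i)) N≢0}}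
  instance
    d≢0 : ℕ.NonZero d
    d≢0 with d∣a zero
    ... | divides q a₀≡q·d = ℕ.m*n≢0⇒n≢0 q {{subst ℕ.NonZero a₀≡q·d (a≢0 zero)}}
  d∣N : d ∣ N
  d∣N = ∣-trans (d∣a zero) (subst (a zero ∣_) (f·a≡N zero) (n∣m*n (f zero)))
  f∣N/d : ∀ i → f i ∣ N / d
  f∣N/d i = subst (f i ∣_) (trans (sym (*-/-assoc (f i) (d∣a i))) (cong (_/ d) (f·a≡N i)))
    (m∣m*n (a i / d))
  d∣1 : d ∣ 1
  d∣1 = *-cancelʳ-∣ N (subst (d ℕ.* N ∣_) (sym (ℕ.*-identityˡ N))
    (m∣n/o⇒o*m∣n d∣N (lcmF-least (suc l) f f∣N/d)))

module System {l} (n : Fin l → ℕ) (n≥1 : ∀ i → 1 ≤ n i)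
                  (u : Fin l → ℚ) (u>0 : ∀ i → Positive (u i)) where

  private instance
    u-positive : ∀ {i} → Positive (u i)
    u-positive {i} = u>0 i
    u-nonZero : ∀ {i} → NonZero (u i)
    u-nonZero {i} = pos⇒nonZero (u i)
    n-nonZero : ∀ {i} → ℕ.NonZero (n i)
    n-nonZero {i} = >-nonZero (n≥1 i)

  N : ℕ
  N = lcmF l n

  cofactor : Fin l → ℕ
  cofactor i = N / n i

  N≡cofactor·n : ∀ i → N ≡ cofactor i ℕ.* n i
  N≡cofactor·n i = trans (sym (m*[n/m]≡n (∣lcmF l n i))) (ℕ.*-comm (n i) (cofactor i))

  gcd≥1 : ∀ i j → 1 ≤ gcd (n i) (n j)
  gcd≥1 i j = ℕ.n≢0⇒n>0 (gcd[m,n]≢0 (n i) (n j) (inj₁ (ℕ.≢-nonZero⁻¹ (n i))))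

  Solution : ℚ → Set
  Solution x = ∀ i → R (n i) (u i * x)

  Compatible : Set
  Compatible = ∀ i j → i ≢ j → R (gcd (n i) (n j)) (u i * 1/ u j)

  solution⇒compatible : ∀ x .{{_ : Positive x}} → Solution x → Compatible
  solution⇒compatible x sol i j _ = subst (R (gcd (n i) (n j))) (*-1/-cancelʳ (u i) (u j) x)
    (R-* {gcd (n i) (n j)} (R-∣ (gcd[m,n]∣m (n i) (n j)) (sol i))
      (R-1/ {{pos*pos⇒pos (u j) x}} (gcd≥1 i j) (R-∣ (gcd[m,n]∣n (n i) (n j)) (sol j))))
    where instance _ = pos⇒nonZero x

  compatible⇒ratio : Compatible → ∀ i j → R (gcd (n i) (n j)) (u i * 1/ u j)
  compatible⇒ratio compatible i j with i ≟ j
  ... | yes refl = subst (R (gcd (n i) (n i))) (sym (ℚ.*-inverseʳ (u i))) (R-1 (gcd (n i) (n i)))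
  ... | no i≢j   = compatible i j i≢j

  module _ (c : Fin l → ℤ) (Σc·cofactor≡1 : Σℤ l (λ i → c i ℤ.* + cofactor i) ≡ + 1) where

    e : Fin l → ℤ
    e i = c i ℤ.* + cofactor i

    particular : ℚ
    particular = Πℚ l (λ i → u i ^ℤ (ℤ.- e i))

    particular-positive : Positive particular
    particular-positive = Πℚ-positive l _ (λ i → ^ℤ-positive (u i) (ℤ.- e i))

    Πℚ-^ℤ-e : ∀ a .{{_ : NonZero a}} → Πℚ l (λ i → a ^ℤ e i) ≡ a
    Πℚ-^ℤ-e a = trans (Πℚ-^ℤ a l e) (trans (cong (a ^ℤ_) Σc·cofactor≡1) (ℚ.*-identityʳ a))

    solution⇒form : ∀ x .{{_ : Positive x}} → Solution x →
      ∃ λ w → Positive w × x ≡ w ^ℕ N * particular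
    solution⇒form x sol = w , Πℚ-positive l _ (λ i → ^ℤ-positive (y i) (c i)) , sym w^N·particular≡x
      where
      instance _ = pos⇒nonZero x
      root : ∀ i → ∃ λ y → Positive y × u i * x ≡ y ^ℕ n i
      root i = R-positive-root {{pos*pos⇒pos (u i) x}} (n≥1 i) (sol i)
      y : Fin l → ℚ
      y i = proj₁ (root i)
      instance
        y-positive : ∀ {i} → Positive (y i)
        y-positive {i} = proj₁ (proj₂ (root i))
        y-nonZero : ∀ {i} → NonZero (y i)
        y-nonZero {i} = pos⇒nonZero (y i)
      w : ℚ
      w = Πℚ l (λ i → y i ^ℤ c i)
      exponent : ∀ i → c i ℤ.* + N ≡ + n i ℤ.* e i
      exponent i = begin
        c i ℤ.* + N                           ≡⟨ cong (λ m → c i ℤ.* + m) (N≡cofactor·n i) ⟩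
        c i ℤ.* + (cofactor i ℕ.* n i)        ≡⟨ cong (c i ℤ.*_) (ℤ.pos-* (cofactor i) (n i)) ⟩
        c i ℤ.* (+ cofactor i ℤ.* + n i)      ≡⟨ solve 3 (λ c a m → c :* (a :* m) := m :* (c :* a))
                                                   refl (c i) (+ cofactor i) (+ n i) ⟩
        + n i ℤ.* e i                         ∎
        where open +-*-Solver
      root-power : ∀ i → (y i ^ℤ c i) ^ℕ N ≡ _^ℤ_ (u i * x) {{*-nonZero (u i) x}} (e i)
      root-power i = begin
        (y i ^ℤ c i) ^ℕ N                                    ≡⟨ ^ℤ-^ℕ (y i) (c i) N ⟩
        y i ^ℤ (c i ℤ.* + N)                                 ≡⟨ cong (y i ^ℤ_) (exponent i) ⟩
        y i ^ℤ (+ n i ℤ.* e i)                               ≡⟨ ^ℤ-* (y i) (+ n i) (e i) ⟨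
        _^ℤ_ (y i ^ℕ n i) {{^ℤ-nonZero (y i) (+ n i)}} (e i) ≡⟨ ^ℤ-congˡ (e i) (proj₂ (proj₂ (root i))) ⟨
        _^ℤ_ (u i * x) {{*-nonZero (u i) x}} (e i)           ∎
      cancel : ∀ i → _^ℤ_ (u i * x) {{*-nonZero (u i) x}} (e i) * u i ^ℤ (ℤ.- e i) ≡ x ^ℤ e i
      cancel i = begin
        _^ℤ_ (u i * x) {{*-nonZero (u i) x}} (e i) * u i ^ℤ (ℤ.- e i)
          ≡⟨ cong (_* u i ^ℤ (ℤ.- e i)) (^ℤ-distrib-* (u i) x (e i)) ⟩
        (u i ^ℤ e i * x ^ℤ e i) * u i ^ℤ (ℤ.- e i)
          ≡⟨ xy∙z≈y∙xz (u i ^ℤ e i) (x ^ℤ e i) (u i ^ℤ (ℤ.- e i)) ⟩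
        x ^ℤ e i * (u i ^ℤ e i * u i ^ℤ (ℤ.- e i))
          ≡⟨ cong (x ^ℤ e i *_) (^ℤ-inverse (u i) (e i)) ⟩
        x ^ℤ e i * 1ℚ
          ≡⟨ ℚ.*-identityʳ (x ^ℤ e i) ⟩
        x ^ℤ e i ∎
      w^N·particular≡x : w ^ℕ N * particular ≡ x
      w^N·particular≡x = begin
        w ^ℕ N * particular
          ≡⟨ cong (_* particular) (trans (Πℚ-^ℕ l _ N) (Πℚ-cong l root-power)) ⟩
        Πℚ l (λ i → _^ℤ_ (u i * x) {{*-nonZero (u i) x}} (e i)) * particular
          ≡⟨ Πℚ-* l _ _ ⟨
        Πℚ l (λ i → _^ℤ_ (u i * x) {{*-nonZero (u i) x}} (e i) * u i ^ℤ (ℤ.- e i))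
          ≡⟨ Πℚ-cong l cancel ⟩
        Πℚ l (λ i → x ^ℤ e i)
          ≡⟨ Πℚ-^ℤ-e x ⟩
        x ∎

    form⇒solution : Compatible → ∀ w → Solution (w ^ℕ N * particular)
    form⇒solution compatible w i = subst (R (n i)) (sym regrouped)
      (R-* {n i} (R-∣ (∣lcmF l n i) (w , refl)) (R-Πℚ (n i) l _ factor-R))
      where
      factor : Fin l → ℚ
      factor j = u i ^ℤ e j * u j ^ℤ (ℤ.- e j)
      ratio-power : ∀ j →
        _^ℤ_ (u i * 1/ u j) {{*-nonZero (u i) (1/ u j) {{ℚ.nonZero⇒1/nonZero (u j)}}}} (e j) ≡ factor j
      ratio-power j = trans (^ℤ-distrib-* (u i) (1/ u j) {{ℚ.nonZero⇒1/nonZero (u j)}} (e j))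
        (cong (u i ^ℤ e j *_) (1/-^ℤ (u j) (e j)))
      n∣cofactor·gcd : ∀ j → n i ∣ cofactor j ℕ.* gcd (n i) (n j)
      n∣cofactor·gcd j = ∣*gcd (cofactor j) (subst (n i ∣_) (N≡cofactor·n j) (∣lcmF l n i))
      factor-R : ∀ j → R (n i) (factor j)
      factor-R j = subst (R (n i)) (ratio-power j)
        (R-^ℤ {{pos*pos⇒pos (u i) (1/ u j) {{1/pos⇒pos (u j)}}}} (gcd≥1 i j)
          (compatible⇒ratio compatible i j) (n∣cofactor·gcd j) (c j))
      regrouped : u i * (w ^ℕ N * particular) ≡ w ^ℕ N * Πℚ l factor
      regrouped = begin
        u i * (w ^ℕ N * particular)                          ≡⟨ x∙yz≈y∙xz (u i) (w ^ℕ N) particular ⟩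
        w ^ℕ N * (u i * particular)                          ≡⟨ cong (λ a → w ^ℕ N * (a * particular)) (Πℚ-^ℤ-e (u i)) ⟨
        w ^ℕ N * (Πℚ l (λ j → u i ^ℤ e j) * particular)      ≡⟨ cong (w ^ℕ N *_) (Πℚ-* l _ _) ⟨
        w ^ℕ N * Πℚ l factor                                 ∎

lemma2 : (l : ℕ) → 1 ≤ l → (n : Fin l → ℕ) → (hn : ∀ i → 1 ≤ n i)
  → (u : Fin l → ℚ) → (hu : ∀ i → Positive (u i))
  → ((∃ λ (x : ℚ) → Positive x × (∀ i → R (n i) (u i * x)))
      ⇔ (∀ i j → i ≢ j → R (gcd (n i) (n j)) (u i * (1/ u j) {{pos⇒nonZero (u j) {{hu j}}}})))
    × ((∀ i j → i ≢ j → R (gcd (n i) (n j)) (u i * (1/ u j) {{pos⇒nonZero (u j) {{hu j}}}}))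
      → (c : Fin l → ℤ)
      → Σℤ l (λ i → c i ℤ.* (+ ((lcmF l n / n i) {{>-nonZero (hn i)}}))) ≡ + 1
      → (x : ℚ) → Positive x
      → ((∀ i → R (n i) (u i * x))
        ⇔ (∃ λ (w : ℚ) → Positive w
            × x ≡ (w ^ℕ lcmF l n)
                  * Πℚ l (λ i → _^ℤ_ (u i) {{pos⇒nonZero (u i) {{hu i}}}}
                                  (ℤ.- (c i ℤ.* (+ ((lcmF l n / n i) {{>-nonZero (hn i)}}))))))))
lemma2 (suc l) _ n hn u hu =
  mk⇔ (λ (x , x>0 , sol) → solution⇒compatible x {{x>0}} sol) compatible⇒solvable , parametrization
  where
  open System n hn u hu
  compatible⇒solvable : Compatible → ∃ λ x → Positive x × Solution x
  compatible⇒solvable compatible with lcmF-cofactors-bézout l n (λ i → >-nonZero (hn i))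
  ... | c , Σ≡1 = 1ℚ ^ℕ N * particular c Σ≡1 ,
    pos*pos⇒pos (1ℚ ^ℕ N) {{^ℕ-positive 1ℚ N}} (particular c Σ≡1) {{particular-positive c Σ≡1}} ,
    form⇒solution c Σ≡1 compatible 1ℚ
  parametrization : Compatible → ∀ c Σ≡1 x → Positive x →
    Solution x ⇔ (∃ λ w → Positive w × x ≡ w ^ℕ N * particular c Σ≡1)
  parametrization compatible c Σ≡1 x x>0 = mk⇔ (solution⇒form c Σ≡1 x {{x>0}})
    (λ (w , _ , x≡) → subst Solution (sym x≡) (form⇒solution c Σ≡1 compatible w))
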